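{- Let $n\ge 1$ and let $\mathcal{R}\subseteq 2^{[2n]}$ be a restrictive collection that contains a copy of $2^{[n]}$. Then there is a restrictive collection $\mathcal{R}^+$ with $\mathcal{R}\subseteq\mathcal{R}^+\subseteq 2^{[2n]}$ that contains a maximal copy of $2^{[n]}$.
   Context: Partition $[2n]$ into the $n$ pairs $\{1,2\},\{3,4\},\dots,\{2n-1,2n\}$. A set $S\subseteq[2n]$ has a pair if it contains both elements of that pair, and misses the pair if it contains neither. A collection $\mathcal{R}\subseteq 2^{[2n]}$ is restrictive if: (i) every $S\in\mathcal{R}$ with $\lceil n/2\rceil\le|S|<n$ has at least one pair; (ii) every $S\in\mathcal{R}$ with $n<|S|\le n+\lfloor n/2\rfloor$ misses no pair; (iii) every $S\in\mathcal{R}$ has $|S|\le n+\lfloor n/2\rfloor$; (iv) whenever $|S_1|=|S_2|=n$, $|S_1\cup S_2|=n+1$ and neither $S_1$ nor $S_2$ has any pair, at most one of $S_1,S_2$ lies in $\mathcal{R}$. A copy of $2^{[n]}$ in $2^{[2n]}$ is the image of a poset embedding $f:2^{[n]}\to2^{[2n]}$ (an injective map with $S\subseteq T\iff f(S)\subseteq f(T)$); its top element is $f([n])$. A copy is maximal if its top element has size $n+\lfloor n/2\rfloor$. -}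

module Defs where

open import Data.Nat using (ℕ; _+_; _*_; _≤_; _<_; ⌊_/2⌋; ⌈_/2⌉)
open import Data.Fin using (Fin; zero; suc; combine)
open import Data.Fin.Subset using (Subset; _∈_; _∉_; _⊆_; _∪_; ∣_∣; ⊤)
open import Data.Bool using (Bool; true)
open import Data.Product using (Σ; ∃; _×_)
open import Data.Empty using (⊥)
open import Relation.Nullary using (¬_)
open import Relation.Binary.PropositionalEquality using (_≡_)
open import Function.Definitions using (Injective)

-- The ground set [2n] is Fin (n * 2) (elements 0,…,2n-1).
-- Pair number i (i : Fin n) consists of the elements 2i and 2i+1,
-- i.e. combine i 0 and combine i 1 (toℕ (combine i j) = 2 * toℕ i + toℕ j).
pairFst pairSnd : {n : ℕ} → Fin n → Fin (n * 2)
pairFst i = combine i zero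
pairSnd i = combine i (suc zero)

record Collection (n : ℕ) : Set where
  constructor collection
  field
    member : Subset (n * 2) → Bool
open Collection public

_∈ᶜ_ : {n : ℕ} → Subset (n * 2) → Collection n → Set
S ∈ᶜ R = member R S ≡ true

_⊆ᶜ_ : {n : ℕ} → Collection n → Collection n → Set
_⊆ᶜ_ {n} R R′ = ∀ (S : Subset (n * 2)) → S ∈ᶜ R → S ∈ᶜ R′

HasPair : (n : ℕ) → Subset (n * 2) → Set
HasPair n S = Σ (Fin n) λ i → pairFst i ∈ S × pairSnd i ∈ S

MissesPair : (n : ℕ) → Subset (n * 2) → Set
MissesPair n S = Σ (Fin n) λ i → pairFst i ∉ S × pairSnd i ∉ S

record Restrictive (n : ℕ) (R : Collection n) : Set where
  field
    cond-i   : ∀ (S : Subset (n * 2)) → S ∈ᶜ R → ⌈ n /2⌉ ≤ ∣ S ∣ → ∣ S ∣ < n → HasPair n S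
    cond-ii  : ∀ (S : Subset (n * 2)) → S ∈ᶜ R → n < ∣ S ∣ → ∣ S ∣ ≤ n + ⌊ n /2⌋ → ¬ MissesPair n S
    cond-iii : ∀ (S : Subset (n * 2)) → S ∈ᶜ R → ∣ S ∣ ≤ n + ⌊ n /2⌋
    -- at most one of S₁, S₂ lies in R (S₁ ≠ S₂ is forced by |S₁ ∪ S₂| = n+1)
    cond-iv  : ∀ (S₁ S₂ : Subset (n * 2)) → ∣ S₁ ∣ ≡ n → ∣ S₂ ∣ ≡ n → ∣ S₁ ∪ S₂ ∣ ≡ n + 1 →
               ¬ HasPair n S₁ → ¬ HasPair n S₂ → S₁ ∈ᶜ R → S₂ ∈ᶜ R → ⊥

record IsEmbedding (n : ℕ) (f : Subset n → Subset (n * 2)) : Set where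
  field
    injective : Injective _≡_ _≡_ f
    order-to   : ∀ (S T : Subset n) → S ⊆ T → f S ⊆ f T
    order-from : ∀ (S T : Subset n) → f S ⊆ f T → S ⊆ T

ContainsCopy : (n : ℕ) → Collection n → Set
ContainsCopy n R = Σ (Subset n → Subset (n * 2)) λ f →
  IsEmbedding n f × (∀ (S : Subset n) → f S ∈ᶜ R)

ContainsMaximalCopy : (n : ℕ) → Collection n → Set
ContainsMaximalCopy n R = Σ (Subset n → Subset (n * 2)) λ f →
  IsEmbedding n f × (∀ (S : Subset n) → f S ∈ᶜ R) × (∣ f ⊤ ∣ ≡ n + ⌊ n /2⌋)

-- If the top T of the given copy is too small, enlarge it to a set T′ of size
-- n + ⌊n/2⌋ that meets every pair: first add one element of each pair that T
-- misses, then pad arbitrarily. The first step stays within n + ⌊n/2⌋ elements: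
-- if |T| > n then T misses no pair by (ii), and if |T| ≤ n the result has
-- n + (number of pairs of T) ≤ n + ⌊n/2⌋ elements. Since |T′| > n and T′ misses
-- no pair, adding T′ to R violates none of (i)–(iv), and replacing the top of
-- the copy by T′ ⊇ T is still a poset embedding.
module Submission where

open import Defs
open import Data.Nat using (ℕ; _≥_; zero; suc; _+_; _*_; _≤_; _<_; z≤n; s≤s; _≤?_; _≟_; ⌊_/2⌋)
open import Data.Nat.Properties
open import Data.Fin using (zero; suc)
open import Data.Fin.Subset using (Subset; _⊆_; ∣_∣; ⊤; ⊥; inside; outside)
open import Data.Fin.Subset.Properties
  using (in⊆in; out⊆; ⊆⊤; ⊥⊆; ∉⊥; ⊆-refl; ⊆-trans; ⊆-antisym; drop-there; ∣⊤∣≡n)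
open import Data.Vec using ([]; _∷_; here; there)
open import Data.Vec.Properties using (≡-dec)
open import Data.Bool using (true; false; _∨_)
import Data.Bool.Properties as Bool
open import Data.Product using (Σ; _×_; ∃; _,_)
open import Data.Sum using (_⊎_; inj₁; inj₂; [_,_]; [_,_]′)
open import Data.Empty using (⊥-elim)
open import Relation.Nullary using (¬_; yes; no; does; contradiction)
open import Relation.Nullary.Decidable using (dec-true)
open import Relation.Binary.Definitions using (DecidableEquality)
open import Relation.Binary.PropositionalEquality using (_≡_; refl; sym; trans; cong; subst)

_≟ˢ_ : ∀ {m} → DecidableEquality (Subset m)
_≟ˢ_ = ≡-dec Bool._≟_

∃-superset-of-size : ∀ {N} (p : Subset N) {t} → ∣ p ∣ ≤ t → t ≤ N →
                     ∃ λ q → p ⊆ q × ∣ q ∣ ≡ t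
∃-superset-of-size [] _ z≤n = [] , ⊆-refl , refl
∃-superset-of-size (inside ∷ p) (s≤s ∣p∣≤t) (s≤s t≤N) =
  let q , p⊆q , ∣q∣≡t = ∃-superset-of-size p ∣p∣≤t t≤N
  in inside ∷ q , in⊆in p⊆q , cong suc ∣q∣≡t
∃-superset-of-size {suc N} (outside ∷ p) {t} ∣p∣≤t t≤1+N with t ≤? N
... | yes t≤N =
  let q , p⊆q , ∣q∣≡t = ∃-superset-of-size p ∣p∣≤t t≤N
  in outside ∷ q , out⊆ p⊆q , ∣q∣≡t
... | no t≰N = ⊤ , ⊆⊤ , trans (∣⊤∣≡n (suc N)) (≤-antisym (≰⇒> t≰N) t≤1+N)

∣p∣≡0⇒p≡⊥ : ∀ {N} (p : Subset N) → ∣ p ∣ ≡ 0 → p ≡ ⊥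
∣p∣≡0⇒p≡⊥ [] _ = refl
∣p∣≡0⇒p≡⊥ (outside ∷ p) ∣p∣≡0 = cong (outside ∷_) (∣p∣≡0⇒p≡⊥ p ∣p∣≡0)

⊆-¬MissesPair : ∀ {m} {U V : Subset (m * 2)} → U ⊆ V → ¬ MissesPair m U → ¬ MissesPair m V
⊆-¬MissesPair U⊆V noMiss (i , fst∉V , snd∉V) =
  noMiss (i , (λ fst∈U → fst∉V (U⊆V fst∈U)) , (λ snd∈U → snd∉V (U⊆V snd∈U)))

¬MissesPair-tail : ∀ {m a b} {U : Subset (m * 2)} →
                   ¬ MissesPair (suc m) (a ∷ b ∷ U) → ¬ MissesPair m U
¬MissesPair-tail noMiss (i , fst∉U , snd∉U) =
  noMiss (suc i , (λ x → fst∉U (drop-there (drop-there x))) , (λ x → snd∉U (drop-there (drop-there x))))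

∷-¬MissesPair : ∀ {m a b} {U : Subset (m * 2)} →
                ¬ MissesPair m U → a ≡ true ⊎ b ≡ true → ¬ MissesPair (suc m) (a ∷ b ∷ U)
∷-¬MissesPair _ (inj₁ refl) (zero , fst∉ , _) = fst∉ here
∷-¬MissesPair _ (inj₂ refl) (zero , _ , snd∉) = snd∉ (there here)
∷-¬MissesPair noMiss _ (suc i , fst∉ , snd∉) =
  noMiss (i , (λ x → fst∉ (there (there x))) , (λ x → snd∉ (there (there x))))

pairCount : ∀ m → Subset (m * 2) → ℕ
pairCount zero [] = 0
pairCount (suc m) (true ∷ true ∷ U) = suc (pairCount m U)
pairCount (suc m) (true ∷ false ∷ U) = pairCount m U
pairCount (suc m) (false ∷ b ∷ U) = pairCount m U

pairCount+pairCount≤∣U∣ : ∀ m (U : Subset (m * 2)) → pairCount m U + pairCount m U ≤ ∣ U ∣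
pairCount+pairCount≤∣U∣ zero [] = z≤n
pairCount+pairCount≤∣U∣ (suc m) (true ∷ true ∷ U) =
  s≤s (≤-trans (≤-reflexive (+-suc _ _)) (s≤s (pairCount+pairCount≤∣U∣ m U)))
pairCount+pairCount≤∣U∣ (suc m) (true ∷ false ∷ U) = m≤n⇒m≤1+n (pairCount+pairCount≤∣U∣ m U)
pairCount+pairCount≤∣U∣ (suc m) (false ∷ true ∷ U) = m≤n⇒m≤1+n (pairCount+pairCount≤∣U∣ m U)
pairCount+pairCount≤∣U∣ (suc m) (false ∷ false ∷ U) = pairCount+pairCount≤∣U∣ m U

cover : ∀ m → Subset (m * 2) → Subset (m * 2)
cover zero [] = []
cover (suc m) (true ∷ b ∷ U) = true ∷ b ∷ cover m U
cover (suc m) (false ∷ true ∷ U) = false ∷ true ∷ cover m U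
cover (suc m) (false ∷ false ∷ U) = true ∷ false ∷ cover m U

⊆-cover : ∀ m (U : Subset (m * 2)) → U ⊆ cover m U
⊆-cover zero [] = ⊆-refl
⊆-cover (suc m) (true ∷ true ∷ U) = in⊆in (in⊆in (⊆-cover m U))
⊆-cover (suc m) (true ∷ false ∷ U) = in⊆in (out⊆ (⊆-cover m U))
⊆-cover (suc m) (false ∷ true ∷ U) = out⊆ (in⊆in (⊆-cover m U))
⊆-cover (suc m) (false ∷ false ∷ U) = out⊆ (out⊆ (⊆-cover m U))

cover-¬MissesPair : ∀ m (U : Subset (m * 2)) → ¬ MissesPair m (cover m U)
cover-¬MissesPair zero [] (() , _)
cover-¬MissesPair (suc m) (true ∷ b ∷ U) = ∷-¬MissesPair (cover-¬MissesPair m U) (inj₁ refl)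
cover-¬MissesPair (suc m) (false ∷ true ∷ U) = ∷-¬MissesPair (cover-¬MissesPair m U) (inj₂ refl)
cover-¬MissesPair (suc m) (false ∷ false ∷ U) = ∷-¬MissesPair (cover-¬MissesPair m U) (inj₁ refl)

∣cover∣≡m+pairCount : ∀ m (U : Subset (m * 2)) → ∣ cover m U ∣ ≡ m + pairCount m U
∣cover∣≡m+pairCount zero [] = refl
∣cover∣≡m+pairCount (suc m) (true ∷ true ∷ U) =
  cong suc (trans (cong suc (∣cover∣≡m+pairCount m U)) (sym (+-suc m _)))
∣cover∣≡m+pairCount (suc m) (true ∷ false ∷ U) = cong suc (∣cover∣≡m+pairCount m U)
∣cover∣≡m+pairCount (suc m) (false ∷ true ∷ U) = cong suc (∣cover∣≡m+pairCount m U)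
∣cover∣≡m+pairCount (suc m) (false ∷ false ∷ U) = cong suc (∣cover∣≡m+pairCount m U)

cover-id : ∀ m (U : Subset (m * 2)) → ¬ MissesPair m U → cover m U ≡ U
cover-id zero [] _ = refl
cover-id (suc m) (true ∷ b ∷ U) noMiss = cong (λ V → true ∷ b ∷ V) (cover-id m U (¬MissesPair-tail noMiss))
cover-id (suc m) (false ∷ true ∷ U) noMiss = cong (λ V → false ∷ true ∷ V) (cover-id m U (¬MissesPair-tail noMiss))
cover-id (suc m) (false ∷ false ∷ U) noMiss = ⊥-elim (noMiss (zero , (λ ()) , λ { (there ()) }))

insert : ∀ {n} → Subset (n * 2) → Collection n → Collection n
insert T R = collection λ S → does (S ≟ˢ T) ∨ member R S

module _ {n : ℕ} (T : Subset (n * 2)) (R : Collection n) where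

  ∈-insert⁻ : ∀ {S} → S ∈ᶜ insert T R → S ≡ T ⊎ S ∈ᶜ R
  ∈-insert⁻ {S} S∈ with S ≟ˢ T
  ... | yes S≡T = inj₁ S≡T
  ... | no _ = inj₂ S∈

  ∈-insert : T ∈ᶜ insert T R
  ∈-insert = cong (_∨ member R T) (dec-true (T ≟ˢ T) refl)

  ⊆ᶜ-insert : R ⊆ᶜ insert T R
  ⊆ᶜ-insert S S∈R = trans (cong (does (S ≟ˢ T) ∨_) S∈R) (Bool.∨-zeroʳ _)

  insert-restrictive : Restrictive n R → n < ∣ T ∣ → ∣ T ∣ ≤ n + ⌊ n /2⌋ → ¬ MissesPair n T →
                       Restrictive n (insert T R)
  insert-restrictive rest n<∣T∣ ∣T∣≤ noMiss = record
    { cond-i = λ S S∈ lo hi →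
        [ (λ { refl → contradiction hi (<-asym n<∣T∣) }) , (λ S∈R → cond-i S S∈R lo hi) ]
          (∈-insert⁻ S∈)
    ; cond-ii = λ S S∈ lo hi → [ (λ { refl → noMiss }) , (λ S∈R → cond-ii S S∈R lo hi) ] (∈-insert⁻ S∈)
    ; cond-iii = λ S S∈ → [ (λ { refl → ∣T∣≤ }) , cond-iii S ] (∈-insert⁻ S∈)
    ; cond-iv = λ S₁ S₂ ∣S₁∣ ∣S₂∣ ∣S₁∪S₂∣ h₁ h₂ S₁∈ S₂∈ →
        [ (λ { refl → ∣T∣≢n ∣S₁∣ })
        , (λ S₁∈R → [ (λ { refl → ∣T∣≢n ∣S₂∣ })
                    , cond-iv S₁ S₂ ∣S₁∣ ∣S₂∣ ∣S₁∪S₂∣ h₁ h₂ S₁∈R ] (∈-insert⁻ S₂∈)) ]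
          (∈-insert⁻ S₁∈)
    }
    where
    open Restrictive rest
    ∣T∣≢n : ¬ ∣ T ∣ ≡ n
    ∣T∣≢n ∣T∣≡n = <⇒≢ n<∣T∣ (sym ∣T∣≡n)

module _ {n : ℕ} (f : Subset n → Subset (n * 2)) (T : Subset (n * 2)) where

  raiseTop : Subset n → Subset (n * 2)
  raiseTop S with S ≟ˢ ⊤
  ... | yes _ = T
  ... | no _ = f S

  raiseTop-⊤ : raiseTop ⊤ ≡ T
  raiseTop-⊤ with ⊤ {n} ≟ˢ ⊤
  ... | yes _ = refl
  ... | no ⊤≢⊤ = contradiction refl ⊤≢⊤

  raiseTop-cases : ∀ S → raiseTop S ≡ T ⊎ raiseTop S ≡ f S
  raiseTop-cases S with S ≟ˢ ⊤
  ... | yes _ = inj₁ refl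
  ... | no _ = inj₂ refl

  raiseTop-embedding : IsEmbedding n f → f ⊤ ⊆ T → IsEmbedding n raiseTop
  raiseTop-embedding emb f⊤⊆T = record
    { injective = λ {S} {S′} eq → ⊆-antisym (reflect S S′ (subst (raiseTop S ⊆_) eq ⊆-refl))
                                            (reflect S′ S (subst (_⊆ raiseTop S) eq ⊆-refl))
    ; order-to = preserve
    ; order-from = reflect
    }
    where
    open IsEmbedding emb
    ⊤⊆⇒≡⊤ : ∀ {S : Subset n} → ⊤ ⊆ S → S ≡ ⊤
    ⊤⊆⇒≡⊤ = ⊆-antisym ⊆⊤

    preserve : ∀ S S′ → S ⊆ S′ → raiseTop S ⊆ raiseTop S′
    preserve S S′ S⊆S′ with S ≟ˢ ⊤ | S′ ≟ˢ ⊤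
    ... | yes _ | yes _ = ⊆-refl
    ... | yes refl | no S′≢⊤ = contradiction (⊤⊆⇒≡⊤ S⊆S′) S′≢⊤
    ... | no _ | yes refl = ⊆-trans (order-to S ⊤ S⊆S′) f⊤⊆T
    ... | no _ | no _ = order-to S S′ S⊆S′

    reflect : ∀ S S′ → raiseTop S ⊆ raiseTop S′ → S ⊆ S′
    reflect S S′ h with S ≟ˢ ⊤ | S′ ≟ˢ ⊤
    ... | yes refl | yes refl = ⊆-refl
    ... | yes refl | no _ = order-from ⊤ S′ (⊆-trans f⊤⊆T h)
    ... | no _ | yes refl = ⊆⊤
    ... | no _ | no _ = order-from S S′ h

embedding-top-nonempty : ∀ {n} {f : Subset (suc n) → Subset (suc n * 2)} →
                         IsEmbedding (suc n) f → 0 < ∣ f ⊤ ∣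
embedding-top-nonempty {f = f} emb = n≢0⇒n>0 λ ∣f⊤∣≡0 →
  ∉⊥ (order-from ⊤ ⊥ (subst (_⊆ f ⊥) (sym (∣p∣≡0⇒p≡⊥ (f ⊤) ∣f⊤∣≡0)) ⊥⊆) here)
  where open IsEmbedding emb

raiseTop-∈-insert : ∀ {n} (R : Collection n) (f : Subset n → Subset (n * 2)) T →
                    (∀ S → f S ∈ᶜ R) → ∀ S → raiseTop f T S ∈ᶜ insert T R
raiseTop-∈-insert R f T f∈R S =
  [ (λ eq → subst (_∈ᶜ insert T R) (sym eq) (∈-insert T R))
  , (λ eq → subst (_∈ᶜ insert T R) (sym eq) (⊆ᶜ-insert T R (f S) (f∈R S))) ]′ (raiseTop-cases f T S)

0<⌊n/2⌋ : ∀ n {c} → 0 < c → c < n + ⌊ n /2⌋ → 0 < ⌊ n /2⌋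
0<⌊n/2⌋ (suc zero) (s≤s z≤n) (s≤s ())
0<⌊n/2⌋ (suc (suc n)) _ _ = s≤s z≤n

pairCovering-superset : ∀ {n R} → Restrictive n R → ∀ {U} → U ∈ᶜ R →
                        ∃ λ T → U ⊆ T × ∣ T ∣ ≡ n + ⌊ n /2⌋ × ¬ MissesPair n T
pairCovering-superset {n} rest {U} U∈R =
  let T , cover⊆T , ∣T∣≡ = ∃-superset-of-size (cover n U) ∣cover∣≤ n+⌊n/2⌋≤n*2
  in T , ⊆-trans (⊆-cover n U) cover⊆T , ∣T∣≡ , ⊆-¬MissesPair cover⊆T (cover-¬MissesPair n U)
  where
  open Restrictive rest
  open ≤-Reasoning

  n+⌊n/2⌋≤n*2 : n + ⌊ n /2⌋ ≤ n * 2
  n+⌊n/2⌋≤n*2 = begin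
    n + ⌊ n /2⌋   ≤⟨ +-monoʳ-≤ n (⌊n/2⌋≤n n) ⟩
    n + n         ≡⟨ cong (n +_) (sym (+-identityʳ n)) ⟩
    2 * n         ≡⟨ *-comm 2 n ⟩
    n * 2         ∎

  ∣cover∣≤ : ∣ cover n U ∣ ≤ n + ⌊ n /2⌋
  ∣cover∣≤ with ∣ U ∣ ≤? n
  ... | yes ∣U∣≤n = begin
    ∣ cover n U ∣                              ≡⟨ ∣cover∣≡m+pairCount n U ⟩
    n + pairCount n U                          ≡⟨ cong (n +_) (n≡⌊n+n/2⌋ (pairCount n U)) ⟩
    n + ⌊ pairCount n U + pairCount n U /2⌋   ≤⟨ +-monoʳ-≤ n (⌊n/2⌋-mono (≤-trans (pairCount+pairCount≤∣U∣ n U) ∣U∣≤n)) ⟩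
    n + ⌊ n /2⌋                                ∎
  ... | no ∣U∣≰n = begin
    ∣ cover n U ∣   ≡⟨ cong ∣_∣ (cover-id n U (cond-ii U U∈R (≰⇒> ∣U∣≰n) (cond-iii U U∈R))) ⟩
    ∣ U ∣           ≤⟨ cond-iii U U∈R ⟩
    n + ⌊ n /2⌋     ∎

corollary1 : (n : ℕ) → n ≥ 1 → (R : Collection n) → Restrictive n R →
    ContainsCopy n R →
    Σ (Collection n) λ R⁺ → Restrictive n R⁺ × R ⊆ᶜ R⁺ × ContainsMaximalCopy n R⁺
corollary1 n@(suc _) (s≤s z≤n) R rest (f , emb , f∈R) with ∣ f ⊤ ∣ ≟ n + ⌊ n /2⌋
... | yes ∣f⊤∣≡ = R , rest , (λ _ S∈R → S∈R) , f , emb , f∈R , ∣f⊤∣≡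
... | no ∣f⊤∣≢ =
  let T , f⊤⊆T , ∣T∣≡ , noMiss = pairCovering-superset rest (f∈R ⊤)
      ∣f⊤∣< = ≤∧≢⇒< (Restrictive.cond-iii rest (f ⊤) (f∈R ⊤)) ∣f⊤∣≢
      n<∣T∣ = subst (n <_) (sym ∣T∣≡) (m<m+n n (0<⌊n/2⌋ n (embedding-top-nonempty emb) ∣f⊤∣<))
  in insert T R
   , insert-restrictive T R rest n<∣T∣ (≤-reflexive ∣T∣≡) noMiss
   , ⊆ᶜ-insert T R
   , raiseTop f T
   , raiseTop-embedding f T emb f⊤⊆T
   , raiseTop-∈-insert R f T f∈R
   , trans (cong ∣_∣ (raiseTop-⊤ f T)) ∣T∣≡
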